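{- Let $\mathcal Q$ be a unital quantale and $I$ a quantic conucleus on $\mathcal Q$ which is unital and strongly square increasing. Then $I$ is central.
   Context: A quantale is a complete join-semilattice with an associative multiplication distributing over arbitrary joins on both sides; unital if it has a unit $\varepsilon$. A quantic conucleus is a map $I$ with $Ia\le a$, $I(Ia)=Ia$, $a\le b\Rightarrow Ia\le Ib$, and $Ia\cdot Ib=I(Ia\cdot Ib)$. A conucleus $I$ is central if $Ia\cdot b=b\cdot Ia$ for all $a,b$; strongly square increasing if $Ia\cdot b\le Ia\cdot b\cdot Ia$ and $b\cdot Ia\le Ia\cdot b\cdot Ia$ for all $a,b$; unital if $Ia\le\varepsilon$ for all $a$. -}

module Defs where

open import Level using (Level; _⊔_; suc)
open import Relation.Binary.PropositionalEquality using (_≡_)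
open import Data.Product using (_×_)

record UnitalQuantale (c ℓ ι : Level) : Set (suc (c ⊔ ℓ ⊔ ι)) where
  infixl 7 _·_
  infix 4 _≤_
  field
    Carrier : Set c
    _≤_     : Carrier → Carrier → Set ℓ
    ≤-refl    : ∀ {a} → a ≤ a
    ≤-trans   : ∀ {a b d} → a ≤ b → b ≤ d → a ≤ d
    ≤-antisym : ∀ {a b} → a ≤ b → b ≤ a → a ≡ b
    ⋁       : {J : Set ι} → (J → Carrier) → Carrier
    ⋁-upper : {J : Set ι} (f : J → Carrier) (j : J) → f j ≤ ⋁ f
    ⋁-least : {J : Set ι} (f : J → Carrier) (b : Carrier) →
              (∀ j → f j ≤ b) → ⋁ f ≤ b
    _·_     : Carrier → Carrier → Carrier
    ·-assoc : ∀ a b d → (a · b) · d ≡ a · (b · d)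
    ε       : Carrier
    ·-identityˡ : ∀ a → ε · a ≡ a
    ·-identityʳ : ∀ a → a · ε ≡ a
    ·-distribˡ-⋁ : ∀ {J : Set ι} (a : Carrier) (f : J → Carrier) →
                   a · ⋁ f ≡ ⋁ (λ j → a · f j)
    ·-distribʳ-⋁ : ∀ {J : Set ι} (f : J → Carrier) (a : Carrier) →
                   ⋁ f · a ≡ ⋁ (λ j → f j · a)

module _ {c ℓ ι : Level} (Q : UnitalQuantale c ℓ ι) where
  open UnitalQuantale Q

  record IsQuanticConucleus (I : Carrier → Carrier) : Set (c ⊔ ℓ) where
    field
      deflationary : ∀ a → I a ≤ a
      idempotent   : ∀ a → I (I a) ≡ I a
      monotone     : ∀ {a b} → a ≤ b → I a ≤ I b
      closed-·     : ∀ a b → I a · I b ≡ I (I a · I b)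

  IsCentral : (Carrier → Carrier) → Set c
  IsCentral I = ∀ a b → I a · b ≡ b · I a

  IsStronglySquareIncreasing : (Carrier → Carrier) → Set (c ⊔ ℓ)
  IsStronglySquareIncreasing I =
    (∀ a b → I a · b ≤ I a · b · I a) × (∀ a b → b · I a ≤ I a · b · I a)

  IsUnitalConucleus : (Carrier → Carrier) → Set (c ⊔ ℓ)
  IsUnitalConucleus I = ∀ a → I a ≤ ε

-- Since every I a lies below the unit, multiplying by I a can only shrink an
-- element: I a · b · I a ≤ ε · b · I a = b · I a, and likewise
-- I a · b · I a ≤ I a · b.  Strong square increase gives the reverse
-- inequalities, so I a · b and b · I a both equal I a · b · I a.
module Submission where

open import Level using (Level; Lift; lift)
open import Data.Bool using (Bool; true; false)
open import Data.Product using (_,_)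
open import Relation.Binary.Bundles using (Preorder)
open import Relation.Binary.PropositionalEquality
  using (_≡_; refl; sym; cong; isEquivalence)
import Relation.Binary.Reasoning.Preorder as PreorderReasoning
open import Defs

module QuantaleProperties {c ℓ ι : Level} (Q : UnitalQuantale c ℓ ι) where
  open UnitalQuantale Q

  preorder : Preorder c c ℓ
  preorder = record
    { Carrier    = Carrier
    ; _≈_        = _≡_
    ; _≲_        = _≤_
    ; isPreorder = record
      { isEquivalence = isEquivalence
      ; reflexive     = λ { refl → ≤-refl }
      ; trans         = ≤-trans
      }
    }

  open PreorderReasoning preorder

  -- The binary join x ∨ y, as the join of a family indexed by a lifted Bool.
  pair : Carrier → Carrier → Lift ι Bool → Carrier
  pair x y (lift true)  = x
  pair x y (lift false) = y

  ⋁-pair-≤ : ∀ {x y} → x ≤ y → ⋁ (pair x y) ≡ y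
  ⋁-pair-≤ {x} {y} x≤y = ≤-antisym
    (⋁-least (pair x y) y λ { (lift true) → x≤y ; (lift false) → ≤-refl })
    (⋁-upper (pair x y) (lift false))

  ·-monoˡ-≤ : ∀ {x y} b → x ≤ y → x · b ≤ y · b
  ·-monoˡ-≤ {x} {y} b x≤y = begin
    x · b                       ≲⟨ ⋁-upper (λ j → pair x y j · b) (lift true) ⟩
    ⋁ (λ j → pair x y j · b)    ≡⟨ sym (·-distribʳ-⋁ (pair x y) b) ⟩
    ⋁ (pair x y) · b            ≡⟨ cong (_· b) (⋁-pair-≤ x≤y) ⟩
    y · b                       ∎

  ·-monoʳ-≤ : ∀ {x y} b → x ≤ y → b · x ≤ b · y
  ·-monoʳ-≤ {x} {y} b x≤y = begin
    b · x                       ≲⟨ ⋁-upper (λ j → b · pair x y j) (lift true) ⟩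
    ⋁ (λ j → b · pair x y j)    ≡⟨ sym (·-distribˡ-⋁ b (pair x y)) ⟩
    b · ⋁ (pair x y)            ≡⟨ cong (b ·_) (⋁-pair-≤ x≤y) ⟩
    b · y                       ∎

  module _ {u : Carrier} (u≤ε : u ≤ ε) where

    sandwich≤·ʳ : ∀ b → u · b · u ≤ b · u
    sandwich≤·ʳ b = begin
      u · b · u   ≲⟨ ·-monoˡ-≤ u (·-monoˡ-≤ b u≤ε) ⟩
      ε · b · u   ≡⟨ cong (_· u) (·-identityˡ b) ⟩
      b · u       ∎

    sandwich≤·ˡ : ∀ b → u · b · u ≤ u · b
    sandwich≤·ˡ b = begin
      u · b · u   ≲⟨ ·-monoʳ-≤ (u · b) u≤ε ⟩
      u · b · ε   ≡⟨ ·-identityʳ (u · b) ⟩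
      u · b       ∎

    ·-comm-if-sandwich≥ : ∀ {b} → u · b ≤ u · b · u → b · u ≤ u · b · u →
                          u · b ≡ b · u
    ·-comm-if-sandwich≥ {b} ub≤ubu bu≤ubu = ≤-antisym
      (≤-trans ub≤ubu (sandwich≤·ʳ b))
      (≤-trans bu≤ubu (sandwich≤·ˡ b))

open QuantaleProperties using (·-comm-if-sandwich≥)

mainTheorem16 : {c ℓ ι : Level} (Q : UnitalQuantale c ℓ ι)
    (I : UnitalQuantale.Carrier Q → UnitalQuantale.Carrier Q) →
    IsQuanticConucleus Q I → IsUnitalConucleus Q I →
    IsStronglySquareIncreasing Q I → IsCentral Q I
mainTheorem16 Q I _ unital (left , right) a b =
  ·-comm-if-sandwich≥ Q (unital a) (left a b) (right a b)
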